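{- Let $n,s,r$ be integers with $s>r\ge 1$ and $n>s+r$. Let $\mathcal F\subset\binom{[n]}{2}$ be such that $|F_1\cup\ldots\cup F_s|\le s+r$ for all choices of $F_1,\ldots,F_s\in\mathcal F$. Then $$|\mathcal F|\le\max\big\{|\mathcal A(r,1,n,2)|,\ |\mathcal A(s+r,2,n,2)|\big\}.$$
   Context: For integers $p\ge r\ge 0$, $\mathcal A(p,r,n,k):=\{A\in\binom{[n]}{k}: |A\cap[p]|\ge r\}$, where $\binom{[n]}{k}$ is the set of $k$-subsets of $[n]=\{1,\ldots,n\}$ and $[p]=\{1,\ldots,p\}$. The sets $F_i$ need not be distinct. -}

module Defs where

open import Data.Nat using (ℕ; zero; suc; _<_; _≤_; _<?_; _≤?_)
open import Data.Bool using (Bool)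
open import Data.Fin using (Fin; toℕ)
open import Data.Fin.Subset using (Subset; inside; outside; _∩_; ∣_∣)
open import Data.List using (List; []; _∷_; _++_; map; filter; length)
open import Data.Vec using (Vec; []; _∷_; tabulate)
open import Data.Product using (_×_)
open import Relation.Nullary.Decidable using (_×-dec_; does)
open import Data.Nat.Properties using (_≟_)

-- The ground set [n] = {1,…,n} is modelled by Fin n (element i ↦ i+1),
-- so [p] (intersected with [n]) is {i : Fin n | toℕ i < p}.
initSeg : (n p : ℕ) → Subset n
initSeg n p = tabulate (λ i → does (toℕ i <? p))

allSubsets : (n : ℕ) → List (Subset n)
allSubsets zero = [] ∷ []
allSubsets (suc n) = map (outside ∷_) (allSubsets n) ++ map (inside ∷_) (allSubsets n)

𝒜 : (p r n k : ℕ) → List (Subset n)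
𝒜 p r n k = filter (λ A → (∣ A ∣ ≟ k) ×-dec (r ≤? ∣ A ∩ initSeg n p ∣)) (allSubsets n)

card𝒜 : (p r n k : ℕ) → ℕ
card𝒜 p r n k = length (𝒜 p r n k)

module Submission where

-- View ℱ as a graph on the points it covers.  If it covers at most s + r points,
-- it has at most (s+r choose 2) = |𝒜(s+r,2,n,2)| edges.  Otherwise it contains no
-- r + 1 pairwise disjoint edges: starting from such a matching (2r + 2 points) and
-- greedily adding edges that cover new points, we would reach s edges covering
-- s + r + 1 points.  By the Erdős–Gallai theorem a graph on n vertices without a
-- matching of size r + 1 has at most max{(2r+1 choose 2), (r choose 2) + r(n−r)}
-- edges; the first term is at most |𝒜(s+r,2,n,2)| and the second is |𝒜(r,1,n,2)|.

open import Defs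
open import Level using (0ℓ)
open import Function using (id; _∘_; _⇔_; mk⇔)
open import Data.Empty using (⊥-elim)
open import Data.Product using (Σ; ∃-syntax; _×_; _,_; proj₁; proj₂)
open import Data.Sum using (_⊎_; inj₁; inj₂; [_,_]′)
open import Data.Bool using (Bool; true; false)
open import Data.Nat using (ℕ; zero; suc; pred; _+_; _*_; _∸_; _≤_; _<_; _⊔_; z≤n; s≤s)
open import Data.Nat.Properties
open import Data.Nat.Induction using (<-rec)
open import Data.Nat.ListAction using (sum)
open import Data.Nat.Tactic.RingSolver using (solve-∀)
open import Algebra.Properties.CommutativeSemigroup +-commutativeSemigroup using (interchange; x∙yz≈z∙xy)
open import Data.Fin using (Fin; zero; suc)
open import Data.Fin.Properties using (any?) renaming (_≟_ to _≟ᶠ_)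
open import Data.Fin.Subset
  using (Subset; inside; outside; ∣_∣; ⋃; _∪_; _∩_; ⊥; ⁅_⁆; _-_; _⊆_; _⊂_)
  renaming (_∈_ to _∈ˢ_; _∉_ to _∉ˢ_)
open import Data.Fin.Subset.Properties
import Data.Vec.Base as Vec
open import Data.Vec using (Vec; []; _∷_; toList)
open import Data.List using (List; []; _∷_; length; filter; map; _++_)
open import Data.List.Properties
  using (length-++; filter-++; filter-accept; filter-reject; filter-notAll; filter-none)
open import Data.List.Membership.Propositional using (_∈_; find; lose)
open import Data.List.Membership.Propositional.Properties
  using (∈-∃++; ∈-++⁻; ∈-++⁺ˡ; ∈-++⁺ʳ; ∈-filter⁺; ∈-filter⁻; ∈-map⁺)
open import Data.List.Relation.Unary.Any using (here; there)
import Data.List.Relation.Unary.Any as Any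
open import Data.List.Relation.Unary.All using (All)
import Data.List.Relation.Unary.All as All
open import Data.List.Relation.Unary.Unique.Propositional using (Unique; []; _∷_)
import Data.List.Relation.Unary.Unique.Propositional.Properties as Unique
import Data.List.Relation.Ternary.Interleaving.Propositional.Properties as Interleaving
open Interleaving using (interleave-length)
open import Relation.Nullary using (¬_; Dec; yes; no; does; ¬?; contradiction)
open import Relation.Nullary.Decidable using (_×-dec_; does-⇔)
open import Relation.Unary using (Pred; Decidable)
open import Relation.Binary.PropositionalEquality
  using (_≡_; _≢_; refl; sym; trans; cong; cong₂; subst; subst₂; module ≡-Reasoning)

private variable
  n : ℕ

∣p∪q∣≤∣p∣+∣q∣ : (p q : Subset n) → ∣ p ∪ q ∣ ≤ ∣ p ∣ + ∣ q ∣
∣p∪q∣≤∣p∣+∣q∣ []            []            = z≤n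
∣p∪q∣≤∣p∣+∣q∣ (outside ∷ p) (outside ∷ q) = ∣p∪q∣≤∣p∣+∣q∣ p q
∣p∪q∣≤∣p∣+∣q∣ (outside ∷ p) (inside  ∷ q) =
  subst (suc ∣ p ∪ q ∣ ≤_) (sym (+-suc ∣ p ∣ ∣ q ∣)) (s≤s (∣p∪q∣≤∣p∣+∣q∣ p q))
∣p∪q∣≤∣p∣+∣q∣ (inside  ∷ p) (outside ∷ q) = s≤s (∣p∪q∣≤∣p∣+∣q∣ p q)
∣p∪q∣≤∣p∣+∣q∣ (inside  ∷ p) (inside  ∷ q) =
  s≤s (≤-trans (∣p∪q∣≤∣p∣+∣q∣ p q) (≤-trans (n≤1+n _) (≤-reflexive (sym (+-suc ∣ p ∣ ∣ q ∣)))))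

Disjoint : Subset n → Subset n → Set
Disjoint p q = ∀ {x} → x ∈ˢ p → x ∉ˢ q

disjoint-∷ : {s t : Bool} {p q : Subset n} → Disjoint (s ∷ p) (t ∷ q) → Disjoint p q
disjoint-∷ d x∈p x∈q = d (Vec.there x∈p) (Vec.there x∈q)

∣p∪q∣≡∣p∣+∣q∣ : (p q : Subset n) → Disjoint p q → ∣ p ∪ q ∣ ≡ ∣ p ∣ + ∣ q ∣
∣p∪q∣≡∣p∣+∣q∣ []            []            _ = refl
∣p∪q∣≡∣p∣+∣q∣ (outside ∷ p) (outside ∷ q) d = ∣p∪q∣≡∣p∣+∣q∣ p q (disjoint-∷ d)
∣p∪q∣≡∣p∣+∣q∣ (outside ∷ p) (inside  ∷ q) d =
  trans (cong suc (∣p∪q∣≡∣p∣+∣q∣ p q (disjoint-∷ d))) (sym (+-suc ∣ p ∣ ∣ q ∣))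
∣p∪q∣≡∣p∣+∣q∣ (inside  ∷ p) (outside ∷ q) d = cong suc (∣p∪q∣≡∣p∣+∣q∣ p q (disjoint-∷ d))
∣p∪q∣≡∣p∣+∣q∣ (inside  ∷ p) (inside  ∷ q) d = contradiction Vec.here (d Vec.here)

disjoint? : (p q : Subset n) → Dec (Disjoint p q)
disjoint? p q with nonempty? (p ∩ q)
... | yes (x , x∈p∩q) = no λ d → let x∈p , x∈q = x∈p∩q⁻ p q x∈p∩q in d x∈p x∈q
... | no  empty       = yes λ x∈p x∈q → empty (_ , x∈p∩q⁺ (x∈p , x∈q))

larger⇒∃∉ : (p q : Subset n) → ∣ q ∣ < ∣ p ∣ → ∃[ x ] x ∈ˢ p × x ∉ˢ q
larger⇒∃∉ (inside  ∷ p) (outside ∷ q) _ = zero , Vec.here , λ ()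
larger⇒∃∉ (inside  ∷ p) (inside  ∷ q) (s≤s q<p) =
  let x , x∈p , x∉q = larger⇒∃∉ p q q<p in suc x , Vec.there x∈p , λ sx∈q → x∉q (drop-there sx∈q)
larger⇒∃∉ (outside ∷ p) (b ∷ q) q<p =
  let x , x∈p , x∉q = larger⇒∃∉ p q (≤-<-trans (∣p∣≤∣x∷p∣ b q) q<p)
  in suc x , Vec.there x∈p , λ sx∈q → x∉q (drop-there sx∈q)

∈⋃⁺ : {L : List (Subset n)} {e : Subset n} {x : Fin n} → e ∈ L → x ∈ˢ e → x ∈ˢ ⋃ L
∈⋃⁺ {L = e ∷ L} (here refl) x∈e = x∈p∪q⁺ (inj₁ x∈e)
∈⋃⁺ {L = f ∷ L} (there e∈L) x∈e = x∈p∪q⁺ (inj₂ (∈⋃⁺ e∈L x∈e))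

∈⋃⁻ : (L : List (Subset n)) {x : Fin n} → x ∈ˢ ⋃ L → ∃[ e ] e ∈ L × x ∈ˢ e
∈⋃⁻ []      x∈⊥ = contradiction x∈⊥ ∉⊥
∈⋃⁻ (e ∷ L) x∈⋃ with x∈p∪q⁻ e (⋃ L) x∈⋃
... | inj₁ x∈e = e , here refl , x∈e
... | inj₂ x∈⋃L = let f , f∈L , x∈f = ∈⋃⁻ L x∈⋃L in f , there f∈L , x∈f

∣⋃∣≤Σ : (L : List (Subset n)) → ∣ ⋃ L ∣ ≤ sum (map ∣_∣ L)
∣⋃∣≤Σ {n} []      = ≤-reflexive (∣⊥∣≡0 n)
∣⋃∣≤Σ     (e ∷ L) = ≤-trans (∣p∪q∣≤∣p∣+∣q∣ e (⋃ L)) (+-monoʳ-≤ ∣ e ∣ (∣⋃∣≤Σ L))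

∣A∩⋃∣≤Σ : (A : Subset n) (L : List (Subset n)) → ∣ A ∩ ⋃ L ∣ ≤ sum (map (λ e → ∣ A ∩ e ∣) L)
∣A∩⋃∣≤Σ {n} A []      = ≤-reflexive (trans (cong ∣_∣ (∩-zeroʳ A)) (∣⊥∣≡0 n))
∣A∩⋃∣≤Σ A (e ∷ L) = begin
  ∣ A ∩ (e ∪ ⋃ L) ∣         ≡⟨ cong ∣_∣ (∩-distribˡ-∪ A e (⋃ L)) ⟩
  ∣ (A ∩ e) ∪ (A ∩ ⋃ L) ∣   ≤⟨ ∣p∪q∣≤∣p∣+∣q∣ (A ∩ e) (A ∩ ⋃ L) ⟩
  ∣ A ∩ e ∣ + ∣ A ∩ ⋃ L ∣   ≤⟨ +-monoʳ-≤ ∣ A ∩ e ∣ (∣A∩⋃∣≤Σ A L) ⟩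
  ∣ A ∩ e ∣ + sum (map (λ e → ∣ A ∩ e ∣) L) ∎
  where open ≤-Reasoning

∣⁅a⁆∪⁅b⁆∣≡2 : {a b : Fin n} → a ≢ b → ∣ ⁅ a ⁆ ∪ ⁅ b ⁆ ∣ ≡ 2
∣⁅a⁆∪⁅b⁆∣≡2 {a = a} {b} a≢b = begin
  ∣ ⁅ a ⁆ ∪ ⁅ b ⁆ ∣     ≡⟨ ∣p∪q∣≡∣p∣+∣q∣ ⁅ a ⁆ ⁅ b ⁆ apart ⟩
  ∣ ⁅ a ⁆ ∣ + ∣ ⁅ b ⁆ ∣ ≡⟨ cong₂ _+_ (∣⁅x⁆∣≡1 a) (∣⁅x⁆∣≡1 b) ⟩
  2                     ∎
  where
  open ≡-Reasoning
  apart : Disjoint ⁅ a ⁆ ⁅ b ⁆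
  apart x∈a x∈b = a≢b (trans (sym (x∈⁅y⁆⇒x≡y a x∈a)) (x∈⁅y⁆⇒x≡y b x∈b))

pair-cases : {e : Subset n} {a b z : Fin n} → ∣ e ∣ ≡ 2 → a ∈ˢ e → b ∈ˢ e → a ≢ b →
             z ∈ˢ e → z ≡ a ⊎ z ≡ b
pair-cases {e = e} {a} {b} {z} e₂ a∈e b∈e a≢b z∈e with z ≟ᶠ a | z ≟ᶠ b
... | yes z≡a | _       = inj₁ z≡a
... | no  _   | yes z≡b = inj₂ z≡b
... | no  z≢a | no  z≢b =
  ⊥-elim (<-irrefl (trans (∣⁅a⁆∪⁅b⁆∣≡2 a≢b) (sym e₂)) (p⊂q⇒∣p∣<∣q∣ ab⊂e))
  where
  ab⊆e : ⁅ a ⁆ ∪ ⁅ b ⁆ ⊆ e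
  ab⊆e x∈ab with x∈p∪q⁻ ⁅ a ⁆ ⁅ b ⁆ x∈ab
  ... | inj₁ x∈a = subst (_∈ˢ e) (sym (x∈⁅y⁆⇒x≡y a x∈a)) a∈e
  ... | inj₂ x∈b = subst (_∈ˢ e) (sym (x∈⁅y⁆⇒x≡y b x∈b)) b∈e
  z∉ab : z ∉ˢ ⁅ a ⁆ ∪ ⁅ b ⁆
  z∉ab z∈ab with x∈p∪q⁻ ⁅ a ⁆ ⁅ b ⁆ z∈ab
  ... | inj₁ z∈a = z≢a (x∈⁅y⁆⇒x≡y a z∈a)
  ... | inj₂ z∈b = z≢b (x∈⁅y⁆⇒x≡y b z∈b)
  ab⊂e : ⁅ a ⁆ ∪ ⁅ b ⁆ ⊂ e
  ab⊂e = ab⊆e , z , z∈e , z∉ab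

partner : (e : Subset n) → ∣ e ∣ ≡ 2 → (u : Fin n) → ∃[ x ] x ∈ˢ e × x ≢ u
partner e e₂ u =
  let x , x∈e , x∉u = larger⇒∃∉ e ⁅ u ⁆ (subst₂ _<_ (sym (∣⁅x⁆∣≡1 u)) (sym e₂) (s≤s (s≤s z≤n)))
  in x , x∈e , x∉⁅y⁆⇒x≢y x∉u

pair-≡ : {e e′ : Subset n} {a b : Fin n} → ∣ e ∣ ≡ 2 → ∣ e′ ∣ ≡ 2 → a ≢ b →
         a ∈ˢ e → b ∈ˢ e → a ∈ˢ e′ → b ∈ˢ e′ → e ≡ e′
pair-≡ e₂ e′₂ a≢b a∈e b∈e a∈e′ b∈e′ =
  ⊆-antisym (into e₂ a∈e b∈e a∈e′ b∈e′) (into e′₂ a∈e′ b∈e′ a∈e b∈e)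
  where
  into : ∀ {p q} → ∣ p ∣ ≡ 2 → _ ∈ˢ p → _ ∈ˢ p → _ ∈ˢ q → _ ∈ˢ q → p ⊆ q
  into p₂ a∈p b∈p a∈q b∈q z∈p with pair-cases p₂ a∈p b∈p a≢b z∈p
  ... | inj₁ refl = a∈q
  ... | inj₂ refl = b∈q

pair-disjoint : {e X : Subset n} {a b : Fin n} → ∣ e ∣ ≡ 2 → a ∈ˢ e → b ∈ˢ e → a ≢ b →
                a ∉ˢ X → b ∉ˢ X → Disjoint e X
pair-disjoint e₂ a∈e b∈e a≢b a∉X b∉X z∈e with pair-cases e₂ a∈e b∈e a≢b z∈e
... | inj₁ refl = a∉X
... | inj₂ refl = b∉X

module _ {A : Set} where

  unique-length : (xs ys : List A) → Unique xs → (∀ {x} → x ∈ xs → x ∈ ys) → length xs ≤ length ys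
  unique-length []       ys _           _    = z≤n
  unique-length (x ∷ xs) ys (x∉xs ∷ xs!) xs⊆ys with ∈-∃++ (xs⊆ys (here refl))
  ... | ys₁ , ys₂ , refl = begin
    suc (length xs)                ≤⟨ s≤s (unique-length xs (ys₁ ++ ys₂) xs! xs⊆ys₁ys₂) ⟩
    suc (length (ys₁ ++ ys₂))      ≡⟨ cong suc (length-++ ys₁) ⟩
    suc (length ys₁ + length ys₂)  ≡⟨ +-suc (length ys₁) (length ys₂) ⟨
    length ys₁ + length (x ∷ ys₂)  ≡⟨ length-++ ys₁ ⟨
    length (ys₁ ++ x ∷ ys₂)        ∎
    where
    open ≤-Reasoning
    xs⊆ys₁ys₂ : ∀ {y} → y ∈ xs → y ∈ ys₁ ++ ys₂
    xs⊆ys₁ys₂ y∈xs with ∈-++⁻ ys₁ (xs⊆ys (there y∈xs))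
    ... | inj₁ y∈ys₁         = ∈-++⁺ˡ y∈ys₁
    ... | inj₂ (here refl)   = ⊥-elim (All.lookup x∉xs y∈xs refl)
    ... | inj₂ (there y∈ys₂) = ∈-++⁺ʳ ys₁ y∈ys₂

  filter-comm : {P Q : Pred A 0ℓ} (P? : Decidable P) (Q? : Decidable Q) (xs : List A) →
                filter P? (filter Q? xs) ≡ filter Q? (filter P? xs)
  filter-comm P? Q? []       = refl
  filter-comm {P} {Q} P? Q? (x ∷ xs) = by (P? x) (Q? x)
    where
    ih = filter-comm P? Q? xs
    by : Dec (P x) → Dec (Q x) → filter P? (filter Q? (x ∷ xs)) ≡ filter Q? (filter P? (x ∷ xs))
    by (yes p) (yes q)
      rewrite filter-accept Q? {xs = xs} q | filter-accept P? {xs = filter Q? xs} p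
            | filter-accept P? {xs = xs} p | filter-accept Q? {xs = filter P? xs} q = cong (x ∷_) ih
    by (yes p) (no ¬q)
      rewrite filter-reject Q? {xs = xs} ¬q | filter-accept P? {xs = xs} p
            | filter-reject Q? {xs = filter P? xs} ¬q = ih
    by (no ¬p) (yes q)
      rewrite filter-accept Q? {xs = xs} q | filter-reject P? {xs = filter Q? xs} ¬p
            | filter-reject P? {xs = xs} ¬p = ih
    by (no ¬p) (no ¬q)
      rewrite filter-reject Q? {xs = xs} ¬q | filter-reject P? {xs = xs} ¬p = ih

  sum-map-+ : (f g : A → ℕ) (xs : List A) →
              sum (map (λ x → f x + g x) xs) ≡ sum (map f xs) + sum (map g xs)
  sum-map-+ f g []       = refl
  sum-map-+ f g (x ∷ xs) =
    trans (cong (f x + g x +_) (sum-map-+ f g xs)) (interchange (f x) (g x) _ _)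

  pigeonhole : (g : A → ℕ) (c : ℕ) (xs : List A) → c * length xs < sum (map g xs) →
               ∃[ x ] x ∈ xs × c < g x
  pigeonhole g c []       big = ⊥-elim (n≮0 (subst (_< 0) (*-zeroʳ c) big))
  pigeonhole g c (x ∷ xs) big with c <? g x
  ... | yes c<gx = x , here refl , c<gx
  ... | no  c≮gx =
    let y , y∈xs , c<gy = pigeonhole g c xs (+-cancelˡ-< c _ _ rest) in y , there y∈xs , c<gy
    where
    rest : c + c * length xs < c + sum (map g xs)
    rest = begin-strict
      c + c * length xs         ≡⟨ *-suc c (length xs) ⟨
      c * suc (length xs)       <⟨ big ⟩
      g x + sum (map g xs)      ≤⟨ +-monoˡ-≤ _ (≮⇒≥ c≮gx) ⟩
      c + sum (map g xs)        ∎
      where open ≤-Reasoning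

  asVec : (m : ℕ) (xs : List A) → length xs ≡ m → Σ (Vec A m) (λ v → toList v ≡ xs)
  asVec zero    []       _   = [] , refl
  asVec (suc m) (x ∷ xs) len =
    let v , v≡xs = asVec m xs (suc-injective len) in x ∷ v , cong (x ∷_) v≡xs

  length-filter-cong : {P Q : Pred A 0ℓ} (P? : Decidable P) (Q? : Decidable Q) →
                       (∀ {x} → P x ⇔ Q x) → (xs : List A) →
                       length (filter P? xs) ≡ length (filter Q? xs)
  length-filter-cong P? Q? P⇔Q []       = refl
  length-filter-cong P? Q? P⇔Q (x ∷ xs)
    with does (P? x) | does (Q? x) | does-⇔ P⇔Q (P? x) (Q? x)
  ... | true  | true  | _  = cong suc (length-filter-cong P? Q? P⇔Q xs)
  ... | false | false | _  = length-filter-cong P? Q? P⇔Q xs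
  ... | true  | false | ()
  ... | false | true  | ()

  length-filter-map : {B : Set} {P : Pred B 0ℓ} (P? : Decidable P) (f : A → B) (xs : List A) →
                      length (filter P? (map f xs)) ≡ length (filter (P? ∘ f) xs)
  length-filter-map P? f []       = refl
  length-filter-map P? f (x ∷ xs) with does (P? (f x))
  ... | true  = cong suc (length-filter-map P? f xs)
  ... | false = length-filter-map P? f xs

-- 𝒮 S k j: the k-subsets of [n] meeting S in at least j points, so that
-- 𝒜 p j n k is 𝒮 [p] k j.  Its size is computed by recursion on n.
𝒮-pred : (S : Subset n) (k j : ℕ) → Decidable (λ A → ∣ A ∣ ≡ k × j ≤ ∣ A ∩ S ∣)
𝒮-pred S k j A = (∣ A ∣ ≟ k) ×-dec (j ≤? ∣ A ∩ S ∣)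

𝒮 : Subset n → ℕ → ℕ → List (Subset n)
𝒮 {n} S k j = filter (𝒮-pred S k j) (allSubsets n)

#𝒮 : Subset n → ℕ → ℕ → ℕ
#𝒮 S k j = length (𝒮 S k j)

#𝒮-∷ : (b : Bool) (S : Subset n) (k j : ℕ) →
       #𝒮 (b ∷ S) k j ≡ #𝒮 S k j + length (filter (𝒮-pred (b ∷ S) k j ∘ (inside ∷_)) (allSubsets n))
#𝒮-∷ {n} b S k j = begin
  length (filter P? (map (outside ∷_) all ++ map (inside ∷_) all))
    ≡⟨ cong length (filter-++ P? (map (outside ∷_) all) _) ⟩
  length (filter P? (map (outside ∷_) all) ++ filter P? (map (inside ∷_) all))
    ≡⟨ length-++ (filter P? (map (outside ∷_) all)) ⟩
  length (filter P? (map (outside ∷_) all)) + length (filter P? (map (inside ∷_) all))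
    ≡⟨ cong₂ _+_ (length-filter-map P? (outside ∷_) all) (length-filter-map P? (inside ∷_) all) ⟩
  #𝒮 S k j + length (filter (P? ∘ (inside ∷_)) all) ∎
  where
  open ≡-Reasoning
  P? = 𝒮-pred (b ∷ S) k j
  all = allSubsets n

-- No nonempty set has size 0, and a new point outside S does not count towards
-- meeting S, while a new point inside S does.
#𝒮-zero : (b : Bool) (S : Subset n) (j : ℕ) → #𝒮 (b ∷ S) 0 j ≡ #𝒮 S 0 j
#𝒮-zero {n} b S j = begin
  #𝒮 (b ∷ S) 0 j      ≡⟨ #𝒮-∷ b S 0 j ⟩
  #𝒮 S 0 j + length (filter (𝒮-pred (b ∷ S) 0 j ∘ (inside ∷_)) (allSubsets n))
    ≡⟨ cong (λ xs → #𝒮 S 0 j + length xs)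
            (filter-none (𝒮-pred (b ∷ S) 0 j ∘ (inside ∷_)) (All.universal (λ { _ (() , _) }) (allSubsets n))) ⟩
  #𝒮 S 0 j + 0        ≡⟨ +-identityʳ _ ⟩
  #𝒮 S 0 j            ∎
  where open ≡-Reasoning

#𝒮-outside : (S : Subset n) (k j : ℕ) → #𝒮 (outside ∷ S) (suc k) j ≡ #𝒮 S (suc k) j + #𝒮 S k j
#𝒮-outside {n} S k j = trans (#𝒮-∷ outside S (suc k) j)
  (cong (#𝒮 S (suc k) j +_) (length-filter-cong (𝒮-pred (outside ∷ S) (suc k) j ∘ (inside ∷_)) (𝒮-pred S k j)
    (mk⇔ (λ (eq , le) → suc-injective eq , le) (λ (eq , le) → cong suc eq , le)) (allSubsets n)))

#𝒮-inside : (S : Subset n) (k j : ℕ) → #𝒮 (inside ∷ S) (suc k) j ≡ #𝒮 S (suc k) j + #𝒮 S k (pred j)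
#𝒮-inside {n} S k j = trans (#𝒮-∷ inside S (suc k) j)
  (cong (#𝒮 S (suc k) j +_) (length-filter-cong (𝒮-pred (inside ∷ S) (suc k) j ∘ (inside ∷_)) (𝒮-pred S k (pred j))
    (mk⇔ (λ (eq , le) → suc-injective eq , shift⁻ j le) (λ (eq , le) → cong suc eq , shift⁺ j le)) (allSubsets n)))
  where
  shift⁻ : ∀ j {m} → j ≤ suc m → pred j ≤ m
  shift⁻ zero    _        = z≤n
  shift⁻ (suc j) (s≤s le) = le
  shift⁺ : ∀ j {m} → pred j ≤ m → j ≤ suc m
  shift⁺ zero    _  = z≤n
  shift⁺ (suc j) le = s≤s le

∈allSubsets : (A : Subset n) → A ∈ allSubsets n
∈allSubsets []            = here refl
∈allSubsets {suc n} (outside ∷ A) = ∈-++⁺ˡ (∈-map⁺ (outside ∷_) (∈allSubsets A))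
∈allSubsets {suc n} (inside  ∷ A) = ∈-++⁺ʳ (map (outside ∷_) (allSubsets n)) (∈-map⁺ (inside ∷_) (∈allSubsets A))

choose2 : ℕ → ℕ
choose2 zero    = 0
choose2 (suc m) = m + choose2 m

#𝒮-0-0 : (S : Subset n) → #𝒮 S 0 0 ≡ 1
#𝒮-0-0 []      = refl
#𝒮-0-0 (b ∷ S) = trans (#𝒮-zero b S 0) (#𝒮-0-0 S)

#𝒮-0-suc : (S : Subset n) (j : ℕ) → #𝒮 S 0 (suc j) ≡ 0
#𝒮-0-suc []      j = refl
#𝒮-0-suc (b ∷ S) j = trans (#𝒮-zero b S (suc j)) (#𝒮-0-suc S j)

#𝒮-1-0 : (S : Subset n) → #𝒮 S 1 0 ≡ n
#𝒮-1-0       []            = refl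
#𝒮-1-0 {suc n} (outside ∷ S) = trans (#𝒮-outside S 0 0) (trans (cong₂ _+_ (#𝒮-1-0 S) (#𝒮-0-0 S)) (+-comm n 1))
#𝒮-1-0 {suc n} (inside  ∷ S) = trans (#𝒮-inside  S 0 0) (trans (cong₂ _+_ (#𝒮-1-0 S) (#𝒮-0-0 S)) (+-comm n 1))

#𝒮-1-1 : (S : Subset n) → #𝒮 S 1 1 ≡ ∣ S ∣
#𝒮-1-1 []            = refl
#𝒮-1-1 (outside ∷ S) = trans (#𝒮-outside S 0 1) (trans (cong₂ _+_ (#𝒮-1-1 S) (#𝒮-0-suc S 0)) (+-identityʳ _))
#𝒮-1-1 (inside  ∷ S) = trans (#𝒮-inside  S 0 1) (trans (cong₂ _+_ (#𝒮-1-1 S) (#𝒮-0-0 S)) (+-comm ∣ S ∣ 1))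

#𝒮-1-2 : (S : Subset n) → #𝒮 S 1 2 ≡ 0
#𝒮-1-2 []            = refl
#𝒮-1-2 (outside ∷ S) = trans (#𝒮-outside S 0 2) (cong₂ _+_ (#𝒮-1-2 S) (#𝒮-0-suc S 1))
#𝒮-1-2 (inside  ∷ S) = trans (#𝒮-inside  S 0 2) (cong₂ _+_ (#𝒮-1-2 S) (#𝒮-0-suc S 0))

#𝒮-2-2 : (S : Subset n) → #𝒮 S 2 2 ≡ choose2 ∣ S ∣
#𝒮-2-2 []            = refl
#𝒮-2-2 (outside ∷ S) = trans (#𝒮-outside S 1 2) (trans (cong₂ _+_ (#𝒮-2-2 S) (#𝒮-1-2 S)) (+-identityʳ _))
#𝒮-2-2 (inside  ∷ S) = trans (#𝒮-inside  S 1 2) (trans (cong₂ _+_ (#𝒮-2-2 S) (#𝒮-1-1 S)) (+-comm _ ∣ S ∣))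

-- The 2-subsets of [n] meeting S: those inside S, and those with one point in and one out.
#𝒮-2-1 : (S : Subset n) → #𝒮 S 2 1 ≡ choose2 ∣ S ∣ + ∣ S ∣ * (n ∸ ∣ S ∣)
#𝒮-2-1 []                    = refl
#𝒮-2-1 {suc n} (outside ∷ S) = begin
  #𝒮 (outside ∷ S) 2 1                   ≡⟨ #𝒮-outside S 1 1 ⟩
  #𝒮 S 2 1 + #𝒮 S 1 1                    ≡⟨ cong₂ _+_ (#𝒮-2-1 S) (#𝒮-1-1 S) ⟩
  choose2 a + a * (n ∸ a) + a             ≡⟨ ring (choose2 a) a (n ∸ a) ⟩
  choose2 a + a * suc (n ∸ a)             ≡⟨ cong (λ d → choose2 a + a * d) (+-∸-assoc 1 (∣p∣≤n S)) ⟨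
  choose2 a + a * (suc n ∸ a)             ∎
  where
  open ≡-Reasoning
  a = ∣ S ∣
  ring : ∀ c a d → c + a * d + a ≡ c + a * suc d
  ring = solve-∀
#𝒮-2-1 {suc n} (inside ∷ S)  = begin
  #𝒮 (inside ∷ S) 2 1                    ≡⟨ #𝒮-inside S 1 1 ⟩
  #𝒮 S 2 1 + #𝒮 S 1 0                    ≡⟨ cong₂ _+_ (#𝒮-2-1 S) (#𝒮-1-0 S) ⟩
  choose2 a + a * (n ∸ a) + n             ≡⟨ cong (choose2 a + a * (n ∸ a) +_) (m+[n∸m]≡n (∣p∣≤n S)) ⟨
  choose2 a + a * (n ∸ a) + (a + (n ∸ a)) ≡⟨ ring (choose2 a) a (n ∸ a) ⟩
  a + choose2 a + suc a * (n ∸ a)         ∎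
  where
  open ≡-Reasoning
  a = ∣ S ∣
  ring : ∀ c a d → c + a * d + (a + d) ≡ a + c + suc a * d
  ring = solve-∀

∣[p]∣≡p : (n p : ℕ) → p ≤ n → ∣ initSeg n p ∣ ≡ p
∣[p]∣≡p n       zero    _        = ∣[0]∣≡0 n
  where
  ∣[0]∣≡0 : ∀ n → ∣ initSeg n 0 ∣ ≡ 0
  ∣[0]∣≡0 zero    = refl
  ∣[0]∣≡0 (suc n) = ∣[0]∣≡0 n
∣[p]∣≡p (suc n) (suc p) (s≤s p≤n) = cong suc (∣[p]∣≡p n p p≤n)

card𝒜-inside : (p n : ℕ) → p ≤ n → card𝒜 p 2 n 2 ≡ choose2 p
card𝒜-inside p n p≤n = trans (#𝒮-2-2 (initSeg n p)) (cong choose2 (∣[p]∣≡p n p p≤n))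

card𝒜-meeting : (r n : ℕ) → r ≤ n → card𝒜 r 1 n 2 ≡ choose2 r + r * (n ∸ r)
card𝒜-meeting r n r≤n =
  trans (#𝒮-2-1 (initSeg n r)) (cong (λ a → choose2 a + a * (n ∸ a)) (∣[p]∣≡p n r r≤n))

record Graph (n : ℕ) : Set where
  field
    V      : Subset n
    E      : List (Subset n)
    pair   : ∀ {e} → e ∈ E → ∣ e ∣ ≡ 2
    inV    : ∀ {e} → e ∈ E → e ⊆ V
    simple : Unique E
open Graph

edgesAt : Graph n → Fin n → List (Subset n)
edgesAt G u = filter (u ∈?_) (E G)

deg : Graph n → Fin n → ℕ
deg G u = length (edgesAt G u)

∈edgesAt⁻ : (G : Graph n) (u : Fin n) {e : Subset n} → e ∈ edgesAt G u → e ∈ E G × u ∈ˢ e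
∈edgesAt⁻ G u = ∈-filter⁻ (u ∈?_) {xs = E G}

isolated-or-edge : (G : Graph n) (u : Fin n) → deg G u ≡ 0 ⊎ ∃[ e ] e ∈ E G × u ∈ˢ e
isolated-or-edge G u with edgesAt G u in at-u
... | []    = inj₁ refl
... | e ∷ _ = inj₂ (e , ∈edgesAt⁻ G u (subst (e ∈_) (sym at-u) (here refl)))

∣E∣≤choose2 : (G : Graph n) → length (E G) ≤ choose2 ∣ V G ∣
∣E∣≤choose2 {n} G = begin
  length (E G)          ≤⟨ unique-length (E G) (𝒮 (V G) 2 2) (simple G) E⊆pairs ⟩
  #𝒮 (V G) 2 2          ≡⟨ #𝒮-2-2 (V G) ⟩
  choose2 ∣ V G ∣       ∎
  where
  open ≤-Reasoning
  E⊆pairs : ∀ {e} → e ∈ E G → e ∈ 𝒮 (V G) 2 2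
  E⊆pairs {e} e∈E = ∈-filter⁺ (𝒮-pred (V G) 2 2) (∈allSubsets e)
    (pair G e∈E , subst (_≤ ∣ e ∩ V G ∣) (pair G e∈E)
                        (p⊆q⇒∣p∣≤∣q∣ (λ x∈e → x∈p∩q⁺ (x∈e , inV G e∈E x∈e))))

infixl 5 _∖_
_∖_ : Graph n → Fin n → Graph n
G ∖ u = record
  { V      = V G - u
  ; E      = filter (¬? ∘ (u ∈?_)) (E G)
  ; pair   = λ e∈ → pair G (proj₁ (∈-filter⁻ (¬? ∘ (u ∈?_)) e∈))
  ; inV    = λ e∈ x∈e → let e∈E , u∉e = ∈-filter⁻ (¬? ∘ (u ∈?_)) e∈ in
               x∈p∧x≢y⇒x∈p-y (inV G e∈E x∈e) (λ { refl → u∉e x∈e })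
  ; simple = Unique.filter⁺ (¬? ∘ (u ∈?_)) (simple G)
  }

∈E∖⁻ : (G : Graph n) (u : Fin n) {e : Subset n} → e ∈ E (G ∖ u) → e ∈ E G × u ∉ˢ e
∈E∖⁻ G u = ∈-filter⁻ (¬? ∘ (u ∈?_))

∣E∣≡deg+∣E∖∣ : (G : Graph n) (u : Fin n) → length (E G) ≡ deg G u + length (E (G ∖ u))
∣E∣≡deg+∣E∖∣ {n} G u = interleave-length {A = Subset n} {B = Subset n} (Interleaving.filter⁺ (u ∈?_) (E G))

deg∖<deg : (G : Graph n) {e : Subset n} {u v : Fin n} → e ∈ E G → u ∈ˢ e → v ∈ˢ e →
           deg (G ∖ u) v < deg G v
deg∖<deg G {e} {u} {v} e∈E u∈e v∈e = begin-strict
  length (filter (v ∈?_) (filter (¬? ∘ (u ∈?_)) (E G)))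
    ≡⟨ cong length (filter-comm (v ∈?_) (¬? ∘ (u ∈?_)) (E G)) ⟩
  length (filter (¬? ∘ (u ∈?_)) (filter (v ∈?_) (E G)))
    <⟨ filter-notAll (¬? ∘ (u ∈?_)) (filter (v ∈?_) (E G))
                     (lose (∈-filter⁺ (v ∈?_) e∈E v∈e) (λ u∉e → u∉e u∈e)) ⟩
  deg G v ∎
  where open ≤-Reasoning

-- A 2-set e through u that differs from every 2-set through u in a list L
-- has a point lying neither in ⁅ u ⁆ nor in ⋃ L: the partner of u in e.
new-point : {u : Fin n} (e : Subset n) (L : List (Subset n)) → ∣ e ∣ ≡ 2 → u ∈ˢ e →
            All (e ≢_) L → (∀ {f} → f ∈ L → ∣ f ∣ ≡ 2 × u ∈ˢ f) →
            ∃[ w ] w ∈ˢ e × w ∉ˢ ⁅ u ⁆ ∪ ⋃ L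
new-point {u = u} e L e₂ u∈e e∉L through-u =
  let w , w∈e , w≢u = partner e e₂ u in
  w , w∈e , λ w∈ → [ w≢u ∘ x∈⁅y⁆⇒x≡y u , w∉⋃L w∈e w≢u ]′ (x∈p∪q⁻ ⁅ u ⁆ (⋃ L) w∈)
  where
  w∉⋃L : ∀ {w} → w ∈ˢ e → w ≢ u → w ∉ˢ ⋃ L
  w∉⋃L w∈e w≢u w∈⋃L =
    let f , f∈L , w∈f = ∈⋃⁻ L w∈⋃L
        f₂ , u∈f = through-u f∈L
    in All.lookup e∉L f∈L (pair-≡ e₂ f₂ w≢u w∈e u∈e w∈f u∈f)

star : (u : Fin n) (L : List (Subset n)) → Unique L → (∀ {e} → e ∈ L → ∣ e ∣ ≡ 2 × u ∈ˢ e) →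
       suc (length L) ≤ ∣ ⁅ u ⁆ ∪ ⋃ L ∣
star u []      _           _         = subst (_≤ ∣ ⁅ u ⁆ ∪ ⊥ ∣) (∣⁅x⁆∣≡1 u) (∣p∣≤∣p∪q∣ ⁅ u ⁆ ⊥)
star u (e ∷ L) (e∉L ∷ L!) through-u = begin
  suc (suc (length L))      ≤⟨ s≤s (star u L L! (through-u ∘ there)) ⟩
  suc ∣ ⁅ u ⁆ ∪ ⋃ L ∣       ≤⟨ p⊂q⇒∣p∣<∣q∣ (grows (new-point e L e₂ u∈e e∉L (through-u ∘ there))) ⟩
  ∣ ⁅ u ⁆ ∪ (e ∪ ⋃ L) ∣     ∎
  where
  open ≤-Reasoning
  e₂ = proj₁ (through-u (here refl))
  u∈e = proj₂ (through-u (here refl))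
  grows : ∃[ w ] w ∈ˢ e × w ∉ˢ ⁅ u ⁆ ∪ ⋃ L → ⁅ u ⁆ ∪ ⋃ L ⊂ ⁅ u ⁆ ∪ (e ∪ ⋃ L)
  grows (w , w∈e , w∉) =
    (λ x∈ → [ x∈p∪q⁺ ∘ inj₁ , x∈p∪q⁺ ∘ inj₂ ∘ x∈p∪q⁺ ∘ inj₂ ]′ (x∈p∪q⁻ ⁅ u ⁆ (⋃ L) x∈)) ,
    w , x∈p∪q⁺ (inj₂ (x∈p∪q⁺ (inj₁ w∈e))) , w∉

N[_,_] : Graph n → Fin n → Subset n
N[ G , u ] = ⁅ u ⁆ ∪ ⋃ (edgesAt G u)

deg<∣N∣ : (G : Graph n) (u : Fin n) → deg G u < ∣ N[ G , u ] ∣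
deg<∣N∣ G u = star u (edgesAt G u) (Unique.filter⁺ (u ∈?_) (simple G))
  (λ e∈ → let e∈E , u∈e = ∈edgesAt⁻ G u e∈ in pair G e∈E , u∈e)

N⊆V : (G : Graph n) {u : Fin n} → u ∈ˢ V G → N[ G , u ] ⊆ V G
N⊆V G {u} u∈V x∈N with x∈p∪q⁻ ⁅ u ⁆ (⋃ (edgesAt G u)) x∈N
... | inj₁ x∈u  = subst (_∈ˢ V G) (sym (x∈⁅y⁆⇒x≡y u x∈u)) u∈V
... | inj₂ x∈⋃ = let e , e∈ , x∈e = ∈⋃⁻ (edgesAt G u) x∈⋃ in
                  inV G (proj₁ (∈edgesAt⁻ G u e∈)) x∈e

deg<∣V∣ : (G : Graph n) {u : Fin n} → u ∈ˢ V G → deg G u < ∣ V G ∣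
deg<∣V∣ G {u} u∈V = ≤-trans (deg<∣N∣ G u) (p⊆q⇒∣p∣≤∣q∣ (N⊆V G u∈V))

-- A matching of size k in G: k edges of G covering at least (hence exactly) 2k
-- vertices.  As edges are 2-sets, this says that they are pairwise disjoint.
record Matching (G : Graph n) (k : ℕ) : Set where
  constructor matching
  field
    edges  : List (Subset n)
    ⊆E     : ∀ {e} → e ∈ edges → e ∈ E G
    size   : length edges ≡ k
    spread : k + k ≤ ∣ ⋃ edges ∣
open Matching

covered : {G : Graph n} {k : ℕ} → Matching G k → Subset n
covered M = ⋃ (edges M)

∣⋃edges∣≤ : (G : Graph n) (L : List (Subset n)) → (∀ {e} → e ∈ L → e ∈ E G) →
            ∣ ⋃ L ∣ ≤ length L + length L
∣⋃edges∣≤ G L L⊆E = ≤-trans (∣⋃∣≤Σ L) (≤-reflexive (Σ∣e∣ L L⊆E))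
  where
  Σ∣e∣ : (L : List (Subset _)) → (∀ {e} → e ∈ L → e ∈ E G) → sum (map ∣_∣ L) ≡ length L + length L
  Σ∣e∣ []      _    = refl
  Σ∣e∣ (e ∷ L) L⊆E = trans (cong₂ _+_ (pair G (L⊆E (here refl))) (Σ∣e∣ L (L⊆E ∘ there)))
                           (cong suc (sym (+-suc (length L) (length L))))

∣covered∣≤ : {G : Graph n} {k : ℕ} (M : Matching G k) → ∣ covered M ∣ ≤ k + k
∣covered∣≤ {G = G} M = subst (λ k → ∣ covered M ∣ ≤ k + k) (size M) (∣⋃edges∣≤ G (edges M) (⊆E M))

empty : {G : Graph n} → Matching G 0
empty = matching [] (λ ()) refl z≤n

extend : {G : Graph n} {k : ℕ} (M : Matching G k) {e : Subset n} → e ∈ E G →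
         Disjoint e (covered M) → Matching G (suc k)
extend {G = G} {k} M {e} e∈E disj = matching (e ∷ edges M) ⊆E′ (cong suc (size M)) spread′
  where
  ⊆E′ : ∀ {f} → f ∈ e ∷ edges M → f ∈ E G
  ⊆E′ (here refl) = e∈E
  ⊆E′ (there f∈M) = ⊆E M f∈M
  spread′ : suc k + suc k ≤ ∣ e ∪ covered M ∣
  spread′ = begin
    suc k + suc k          ≡⟨ cong suc (+-suc k k) ⟩
    2 + (k + k)            ≤⟨ +-monoʳ-≤ 2 (spread M) ⟩
    2 + ∣ covered M ∣      ≡⟨ cong (_+ ∣ covered M ∣) (pair G e∈E) ⟨
    ∣ e ∣ + ∣ covered M ∣  ≡⟨ ∣p∪q∣≡∣p∣+∣q∣ e (covered M) disj ⟨
    ∣ e ∪ covered M ∣      ∎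
    where open ≤-Reasoning

lift : (G : Graph n) {u : Fin n} {k : ℕ} → Matching (G ∖ u) k → Matching G k
lift G {u} M = matching (edges M) (proj₁ ∘ ∈E∖⁻ G u ∘ ⊆E M) (size M) (spread M)

avoids : (G : Graph n) {u : Fin n} {k : ℕ} (M : Matching (G ∖ u) k) → u ∉ˢ covered M
avoids G {u} M u∈C = let e , e∈M , u∈e = ∈⋃⁻ (edges M) u∈C in proj₂ (∈E∖⁻ G u (⊆E M e∈M)) u∈e

no-edges : (G : Graph n) → ¬ Matching G 1 → length (E G) ≡ 0
no-edges G no-M with E G in eq
... | []    = refl
... | e ∷ _ = ⊥-elim (no-M (extend empty (subst (e ∈_) (sym eq) (here refl)) (λ _ → ∉⊥)))

-- If G has no matching of size r+1 and deg v ≥ 2r+1, then G ∖ v has no matching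
-- of size r: such a matching M covers 2r vertices, so some neighbour w of v is
-- uncovered and M extends by the edge vw.
high-degree : (G : Graph n) {r : ℕ} {v : Fin n} → ¬ Matching G (suc r) →
              r + suc r ≤ deg G v → ¬ Matching (G ∖ v) r
high-degree G {r} {v} no-M big M with larger⇒∃∉ N[ G , v ] (⁅ v ⁆ ∪ covered M) small
  where
  small : ∣ ⁅ v ⁆ ∪ covered M ∣ < ∣ N[ G , v ] ∣
  small = begin-strict
    ∣ ⁅ v ⁆ ∪ covered M ∣        ≤⟨ ∣p∪q∣≤∣p∣+∣q∣ ⁅ v ⁆ (covered M) ⟩
    ∣ ⁅ v ⁆ ∣ + ∣ covered M ∣    ≤⟨ +-mono-≤ (≤-reflexive (∣⁅x⁆∣≡1 v)) (∣covered∣≤ M) ⟩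
    suc (r + r)                  ≡⟨ +-suc r r ⟨
    r + suc r                    ≤⟨ big ⟩
    deg G v                      <⟨ deg<∣N∣ G v ⟩
    ∣ N[ G , v ] ∣               ∎
    where open ≤-Reasoning
... | w , w∈N , w∉ with x∈p∪q⁻ ⁅ v ⁆ (⋃ (edgesAt G v)) w∈N
...   | inj₁ w∈v = w∉ (x∈p∪q⁺ (inj₁ w∈v))
...   | inj₂ w∈⋃ with ∈⋃⁻ (edgesAt G v) w∈⋃
...     | e , e∈at , w∈e with ∈edgesAt⁻ G v e∈at
...       | e∈E , v∈e = no-M (extend (lift G M) e∈E (pair-disjoint (pair G e∈E) v∈e w∈e v≢w (avoids G M) w∉C))
  where
  v≢w : v ≢ w
  v≢w refl = w∉ (x∈p∪q⁺ (inj₁ (x∈⁅x⁆ v)))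
  w∉C : w ∉ˢ covered M
  w∉C = w∉ ∘ x∈p∪q⁺ ∘ inj₂

-- If G has no matching of size q+1 and uv is an edge, then G ∖ u ∖ v has no
-- matching of size q: uv would extend it.
without-edge : (G : Graph n) {q : ℕ} {e : Subset n} {u v : Fin n} → ¬ Matching G (suc q) →
               e ∈ E G → u ∈ˢ e → v ∈ˢ e → u ≢ v → ¬ Matching (G ∖ u ∖ v) q
without-edge G {u = u} no-M e∈E u∈e v∈e u≢v M =
  no-M (extend (lift G (lift (G ∖ u) M)) e∈E
               (pair-disjoint (pair G e∈E) u∈e v∈e u≢v (avoids G (lift (G ∖ u) M)) (avoids (G ∖ u) M)))

∣E∣<∣E∖∖∣+deg+deg : (G : Graph n) {e : Subset n} {u v : Fin n} → e ∈ E G → u ∈ˢ e → v ∈ˢ e →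
                     length (E G) < length (E (G ∖ u ∖ v)) + (deg G u + deg G v)
∣E∣<∣E∖∖∣+deg+deg G {e} {u} {v} e∈E u∈e v∈e = begin-strict
  length (E G)                                       ≡⟨ ∣E∣≡deg+∣E∖∣ G u ⟩
  deg G u + length (E (G ∖ u))                       ≡⟨ cong (deg G u +_) (∣E∣≡deg+∣E∖∣ (G ∖ u) v) ⟩
  deg G u + (deg (G ∖ u) v + length (E (G ∖ u ∖ v))) <⟨ +-monoʳ-< (deg G u) (+-monoˡ-< _ (deg∖<deg G e∈E u∈e v∈e)) ⟩
  deg G u + (deg G v + length (E (G ∖ u ∖ v)))       ≡⟨ x∙yz≈z∙xy (deg G u) (deg G v) _ ⟩
  length (E (G ∖ u ∖ v)) + (deg G u + deg G v)       ∎
  where open ≤-Reasoning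

tight-cover : {X e U : Subset n} {ρ : ℕ} → ∣ e ∣ ≡ 2 → ∣ U ∣ ≤ ρ + ρ → suc ρ + suc ρ ≤ ∣ X ∣ →
              X ⊆ e ∪ U → ρ + ρ ≤ ∣ U ∣ × Disjoint e U
tight-cover {X = X} {e} {U} {ρ} e₂ U≤ X≥ X⊆ = large , disjoint
  where
  2ρ+2≤∣X∣ : 2 + (ρ + ρ) ≤ ∣ X ∣
  2ρ+2≤∣X∣ = subst (_≤ ∣ X ∣) (cong suc (+-suc ρ ρ)) X≥
  large : ρ + ρ ≤ ∣ U ∣
  large = +-cancelˡ-≤ 2 _ _ (begin
    2 + (ρ + ρ)      ≤⟨ 2ρ+2≤∣X∣ ⟩
    ∣ X ∣            ≤⟨ p⊆q⇒∣p∣≤∣q∣ X⊆ ⟩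
    ∣ e ∪ U ∣        ≤⟨ ∣p∪q∣≤∣p∣+∣q∣ e U ⟩
    ∣ e ∣ + ∣ U ∣    ≡⟨ cong (_+ ∣ U ∣) e₂ ⟩
    2 + ∣ U ∣        ∎)
    where open ≤-Reasoning
  -- if a ∈ e were in U, then X ⊆ ⁅ b ⁆ ∪ U for the partner b of a, which is too small
  disjoint : Disjoint e U
  disjoint {a} a∈e a∈U = 1+n≰n (≤-pred (begin
    2 + (ρ + ρ)          ≤⟨ 2ρ+2≤∣X∣ ⟩
    ∣ X ∣                ≤⟨ p⊆q⇒∣p∣≤∣q∣ X⊆bU ⟩
    ∣ ⁅ b ⁆ ∪ U ∣        ≤⟨ ∣p∪q∣≤∣p∣+∣q∣ ⁅ b ⁆ U ⟩
    ∣ ⁅ b ⁆ ∣ + ∣ U ∣    ≤⟨ +-mono-≤ (≤-reflexive (∣⁅x⁆∣≡1 b)) U≤ ⟩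
    1 + (ρ + ρ)          ∎))
    where
    open ≤-Reasoning
    b = proj₁ (partner e e₂ a)
    b∈e = proj₁ (proj₂ (partner e e₂ a))
    b≢a = proj₂ (proj₂ (partner e e₂ a))
    X⊆bU : X ⊆ ⁅ b ⁆ ∪ U
    X⊆bU z∈X with x∈p∪q⁻ e U (X⊆ z∈X)
    ... | inj₂ z∈U = x∈p∪q⁺ (inj₂ z∈U)
    ... | inj₁ z∈e with pair-cases e₂ b∈e a∈e b≢a z∈e
    ...   | inj₁ refl = x∈p∪q⁺ (inj₁ (x∈⁅x⁆ b))
    ...   | inj₂ refl = x∈p∪q⁺ (inj₂ a∈U)

remove : {G : Graph n} {k : ℕ} (M : Matching G k) {e : Subset n} → e ∈ edges M →
         ∃[ ρ ] k ≡ suc ρ × Σ (Matching G ρ) λ R → covered R ⊆ covered M × Disjoint e (covered R)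
remove {G = G} {k} M {e} e∈M with ∈-∃++ e∈M
... | M₁ , M₂ , M≡ = ρ , k≡1+ρ , matching (M₁ ++ M₂) ⊆E′ refl (proj₁ tight) , R⊆M , proj₂ tight
  where
  ρ = length (M₁ ++ M₂)
  ∈M : ∀ {f} → f ∈ M₁ ++ M₂ → f ∈ edges M
  ∈M f∈ = subst (_ ∈_) (sym M≡) ([ ∈-++⁺ˡ , ∈-++⁺ʳ M₁ ∘ there ]′ (∈-++⁻ M₁ f∈))
  ⊆E′ : ∀ {f} → f ∈ M₁ ++ M₂ → f ∈ E G
  ⊆E′ = ⊆E M ∘ ∈M
  k≡1+ρ : k ≡ suc ρ
  k≡1+ρ = begin
    k                                     ≡⟨ size M ⟨
    length (edges M)                      ≡⟨ cong length M≡ ⟩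
    length (M₁ ++ e ∷ M₂)                 ≡⟨ length-++ M₁ ⟩
    length M₁ + suc (length M₂)           ≡⟨ +-suc (length M₁) (length M₂) ⟩
    suc (length M₁ + length M₂)           ≡⟨ cong suc (length-++ M₁) ⟨
    suc ρ                                 ∎
    where open ≡-Reasoning
  R⊆M : ⋃ (M₁ ++ M₂) ⊆ covered M
  R⊆M z∈ = let f , f∈ , z∈f = ∈⋃⁻ (M₁ ++ M₂) z∈ in ∈⋃⁺ (∈M f∈) z∈f
  M⊆eR : covered M ⊆ e ∪ ⋃ (M₁ ++ M₂)
  M⊆eR z∈ with ∈⋃⁻ (edges M) z∈
  ... | f , f∈M , z∈f with ∈-++⁻ M₁ (subst (f ∈_) M≡ f∈M)
  ...   | inj₁ f∈M₁         = x∈p∪q⁺ (inj₂ (∈⋃⁺ (∈-++⁺ˡ f∈M₁) z∈f))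
  ...   | inj₂ (here refl)  = x∈p∪q⁺ (inj₁ z∈f)
  ...   | inj₂ (there f∈M₂) = x∈p∪q⁺ (inj₂ (∈⋃⁺ (∈-++⁺ʳ M₁ f∈M₂) z∈f))
  tight : ρ + ρ ≤ ∣ ⋃ (M₁ ++ M₂) ∣ × Disjoint e (⋃ (M₁ ++ M₂))
  tight = tight-cover (pair G (⊆E M e∈M)) (∣⋃edges∣≤ G (M₁ ++ M₂) ⊆E′)
                      (subst (λ k → k + k ≤ ∣ covered M ∣) k≡1+ρ (spread M)) M⊆eR

∉pair : {e : Subset n} {a b z : Fin n} → ∣ e ∣ ≡ 2 → a ∈ˢ e → b ∈ˢ e → a ≢ b →
        z ≢ a → z ≢ b → z ∉ˢ e
∉pair e₂ a∈e b∈e a≢b z≢a z≢b z∈e = [ z≢a , z≢b ]′ (pair-cases e₂ a∈e b∈e a≢b z∈e)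

∈∉⇒≢ : {X : Subset n} {a b : Fin n} → a ∈ˢ X → b ∉ˢ X → a ≢ b
∈∉⇒≢ a∈X b∉X refl = b∉X a∈X

switch : {G : Graph n} {k : ℕ} (M : Matching G k) {e f g : Subset n} {x y s t : Fin n} →
         e ∈ edges M → x ∈ˢ e → y ∈ˢ e → x ≢ y →
         f ∈ E G → s ∈ˢ f → x ∈ˢ f → g ∈ E G → t ∈ˢ g → y ∈ˢ g →
         s ∉ˢ covered M → t ∉ˢ covered M → s ≢ t → Matching G (suc k)
switch {G = G} M {e} {f} {g} {x} {y} {s} {t} e∈M x∈e y∈e x≢y f∈E s∈f x∈f g∈E t∈g y∈g s∉C t∉C s≢t
  with remove M e∈M
... | _ , refl , R , R⊆C , e∩R=∅ = extend (extend R g∈E g-disj) f∈E f-disj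
  where
  x∈C = ∈⋃⁺ e∈M x∈e
  y∈C = ∈⋃⁺ e∈M y∈e
  t≢y = ∈∉⇒≢ y∈C t∉C ∘ sym
  g₂ = pair G g∈E
  g-disj : Disjoint g (covered R)
  g-disj = pair-disjoint g₂ t∈g y∈g t≢y (t∉C ∘ R⊆C) (e∩R=∅ y∈e)
  s∉gR : s ∉ˢ g ∪ covered R
  s∉gR = [ ∉pair g₂ t∈g y∈g t≢y s≢t (∈∉⇒≢ y∈C s∉C ∘ sym) , s∉C ∘ R⊆C ]′ ∘ x∈p∪q⁻ g (covered R)
  x∉gR : x ∉ˢ g ∪ covered R
  x∉gR = [ ∉pair g₂ t∈g y∈g t≢y (∈∉⇒≢ x∈C t∉C) x≢y , e∩R=∅ x∈e ]′ ∘ x∈p∪q⁻ g (covered R)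
  f-disj : Disjoint f (g ∪ covered R)
  f-disj = pair-disjoint (pair G f∈E) s∈f x∈f (∈∉⇒≢ x∈C s∉C ∘ sym) s∉gR x∉gR

⊆∧≥⇒⊇ : {p q : Subset n} → p ⊆ q → ∣ q ∣ ≤ ∣ p ∣ → q ⊆ p
⊆∧≥⇒⊇ {p = p} {q} p⊆q q≤p {z} z∈q with z ∈? p
... | yes z∈p = z∈p
... | no  z∉p = contradiction (p⊂q⇒∣p∣<∣q∣ (p⊆q , z , z∈q , z∉p)) (≤⇒≯ q≤p)

split-3 : (a b : ℕ) → 2 < a + b → a ≤ 2 → b ≤ 2 → (2 ≤ a × 1 ≤ b) ⊎ (2 ≤ b × 1 ≤ a)
split-3 0             b       2<b   _             b≤2 = ⊥-elim (<⇒≱ 2<b b≤2)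
split-3 1             b       2<1+b _             _   = inj₂ (≤-pred 2<1+b , ≤-refl)
split-3 2             0       2<2   _             _   = ⊥-elim (<-irrefl refl 2<2)
split-3 2             (suc b) _     _             _   = inj₁ (≤-refl , s≤s z≤n)
split-3 (suc (suc (suc a))) _ _     (s≤s (s≤s ())) _

-- If every vertex has degree > k and there are at least 2k+2
-- vertices, every matching M of size k can be enlarged: take two uncovered
-- vertices u, v.  If an edge at u or v avoids the covered set C, add it.
-- Otherwise u and v each have more than k neighbours in C, so by pigeonhole some
-- edge {x,y} of M has x adjacent to one of them and y to the other; switch.
module Augmentation (G : Graph n) {k : ℕ} (min-deg : ∀ {u} → u ∈ˢ V G → k < deg G u)
                    (roomy : suc k + suc k ≤ ∣ V G ∣) (M : Matching G k) where

  C : Subset n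
  C = covered M

  A : Fin n → Subset n
  A t = C ∩ ⋃ (edgesAt G t)

  Stuck : Fin n → Set
  Stuck t = ∀ {e} → e ∈ E G → t ∈ˢ e → ¬ Disjoint e C

  extend-at : (t : Fin n) → Matching G (suc k) ⊎ Stuck t
  extend-at t with Any.any? (λ e → (t ∈? e) ×-dec disjoint? e C) (E G)
  ... | yes some = let _ , e∈E , _ , disj = find some in inj₁ (extend M e∈E disj)
  ... | no  none = inj₂ λ e∈E t∈e disj → none (lose e∈E (t∈e , disj))

  many-neighbours : {t : Fin n} → t ∈ˢ V G → t ∉ˢ C → Stuck t → k < ∣ A t ∣
  many-neighbours {t} t∈V t∉C stuck = ≤-pred (begin-strict
    suc k                     ≤⟨ min-deg t∈V ⟩
    deg G t                   <⟨ deg<∣N∣ G t ⟩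
    ∣ N[ G , t ] ∣            ≤⟨ p⊆q⇒∣p∣≤∣q∣ N⊆tA ⟩
    ∣ ⁅ t ⁆ ∪ A t ∣           ≤⟨ ∣p∪q∣≤∣p∣+∣q∣ ⁅ t ⁆ (A t) ⟩
    ∣ ⁅ t ⁆ ∣ + ∣ A t ∣       ≡⟨ cong (_+ ∣ A t ∣) (∣⁅x⁆∣≡1 t) ⟩
    suc ∣ A t ∣               ∎)
    where
    open ≤-Reasoning
    N⊆tA : N[ G , t ] ⊆ ⁅ t ⁆ ∪ A t
    N⊆tA x∈N with x∈p∪q⁻ ⁅ t ⁆ (⋃ (edgesAt G t)) x∈N
    ... | inj₁ x∈t = x∈p∪q⁺ (inj₁ x∈t)
    ... | inj₂ x∈⋃ with ∈⋃⁻ (edgesAt G t) x∈⋃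
    ...   | e , e∈at , x∈e with ∈edgesAt⁻ G t e∈at | nonempty? (e ∩ C)
    ...     | e∈E , t∈e | no  e∩C=∅       = ⊥-elim (stuck e∈E t∈e λ z∈e z∈C → e∩C=∅ (_ , x∈p∩q⁺ (z∈e , z∈C)))
    ...     | e∈E , t∈e | yes (y , y∈e∩C) with x∈p∩q⁻ e C y∈e∩C
    ...       | y∈e , y∈C with pair-cases (pair G e∈E) t∈e y∈e (∈∉⇒≢ y∈C t∉C ∘ sym) x∈e
    ...         | inj₁ refl = x∈p∪q⁺ (inj₁ (x∈⁅x⁆ t))
    ...         | inj₂ refl = x∈p∪q⁺ (inj₂ (x∈p∩q⁺ (y∈C , ∈⋃⁺ e∈at y∈e)))

  -- Two distinct uncovered vertices u and v (C has at most 2k points).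
  private
    ∣C∣+1<∣V∣ : suc ∣ C ∣ < ∣ V G ∣
    ∣C∣+1<∣V∣ = begin-strict
      suc ∣ C ∣          ≤⟨ s≤s (∣covered∣≤ M) ⟩
      suc (k + k)        <⟨ s≤s (≤-reflexive (sym (+-suc k k))) ⟩
      suc k + suc k      ≤⟨ roomy ⟩
      ∣ V G ∣            ∎
      where open ≤-Reasoning

    first : ∃[ u ] u ∈ˢ V G × u ∉ˢ C
    first = larger⇒∃∉ (V G) C (<-trans (n<1+n _) ∣C∣+1<∣V∣)

    second : ∃[ v ] v ∈ˢ V G × v ∉ˢ ⁅ proj₁ first ⁆ ∪ C
    second = larger⇒∃∉ (V G) (⁅ proj₁ first ⁆ ∪ C) (≤-<-trans
      (≤-trans (∣p∪q∣≤∣p∣+∣q∣ ⁅ proj₁ first ⁆ C) (≤-reflexive (cong (_+ ∣ C ∣) (∣⁅x⁆∣≡1 (proj₁ first)))))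
      ∣C∣+1<∣V∣)

  u v : Fin n
  u = proj₁ first
  v = proj₁ second

  u∈V : u ∈ˢ V G
  u∈V = proj₁ (proj₂ first)
  v∈V : v ∈ˢ V G
  v∈V = proj₁ (proj₂ second)
  u∉C : u ∉ˢ C
  u∉C = proj₂ (proj₂ first)
  v∉C : v ∉ˢ C
  v∉C = proj₂ (proj₂ second) ∘ x∈p∪q⁺ ∘ inj₂
  u≢v : u ≢ v
  u≢v u≡v = proj₂ (proj₂ second) (x∈p∪q⁺ (inj₁ (subst (_∈ˢ ⁅ u ⁆) u≡v (x∈⁅x⁆ u))))

  -- Pigeonhole: more than 2k incidences of A u and A v with the k edges of M,
  -- so some edge of M carries at least three.
  crowded-edge : k < ∣ A u ∣ → k < ∣ A v ∣ → ∃[ e ] e ∈ edges M × 2 < ∣ A u ∩ e ∣ + ∣ A v ∩ e ∣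
  crowded-edge k<Au k<Av = pigeonhole (λ e → ∣ A u ∩ e ∣ + ∣ A v ∩ e ∣) 2 (edges M) (begin-strict
    2 * length (edges M)                    ≡⟨ cong (2 *_) (size M) ⟩
    k + (k + 0)                             ≡⟨ cong (k +_) (+-identityʳ k) ⟩
    k + k                                   <⟨ +-mono-< k<Au k<Av ⟩
    ∣ A u ∣ + ∣ A v ∣                        ≤⟨ +-mono-≤ (in-edges u) (in-edges v) ⟩
    Σₘ (λ e → ∣ A u ∩ e ∣) + Σₘ (λ e → ∣ A v ∩ e ∣) ≡⟨ sum-map-+ _ _ (edges M) ⟨
    Σₘ (λ e → ∣ A u ∩ e ∣ + ∣ A v ∩ e ∣)     ∎)
    where
    open ≤-Reasoning
    Σₘ : (Subset n → ℕ) → ℕ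
    Σₘ g = sum (map g (edges M))
    in-edges : ∀ t → ∣ A t ∣ ≤ Σₘ (λ e → ∣ A t ∩ e ∣)
    in-edges t = ≤-trans (p⊆q⇒∣p∣≤∣q∣ (λ x∈A → x∈p∩q⁺ (x∈A , proj₁ (x∈p∩q⁻ C _ x∈A))))
                         (∣A∩⋃∣≤Σ (A t) (edges M))

  edge-to : {t z : Fin n} → z ∈ˢ A t → ∃[ f ] f ∈ E G × t ∈ˢ f × z ∈ˢ f
  edge-to {t} z∈A =
    let f , f∈at , z∈f = ∈⋃⁻ (edgesAt G t) (proj₂ (x∈p∩q⁻ C _ z∈A))
        f∈E , t∈f = ∈edgesAt⁻ G t f∈at
    in f , f∈E , t∈f , z∈f

  full-edge : {s : Fin n} {e : Subset n} → e ∈ edges M → 2 ≤ ∣ A s ∩ e ∣ → e ⊆ A s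
  full-edge {s} {e} e∈M 2≤ = proj₁ ∘ x∈p∩q⁻ (A s) e ∘
    ⊆∧≥⇒⊇ (p∩q⊆q (A s) e) (subst (_≤ ∣ A s ∩ e ∣) (sym (pair G (⊆E M e∈M))) 2≤)

  switch-via : {s t : Fin n} {e : Subset n} → s ∉ˢ C → t ∉ˢ C → s ≢ t → e ∈ edges M →
               2 ≤ ∣ A s ∩ e ∣ → 1 ≤ ∣ A t ∩ e ∣ → Matching G (suc k)
  switch-via {s} {t} {e} s∉C t∉C s≢t e∈M 2≤ 1≤
    with larger⇒∃∉ (A t ∩ e) ⊥ (subst (_< ∣ A t ∩ e ∣) (sym (∣⊥∣≡0 n)) 1≤)
  ... | y , y∈Ate , _ with x∈p∩q⁻ (A t) e y∈Ate
  ... | y∈At , y∈e with partner e (pair G (⊆E M e∈M)) y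
  ... | x , x∈e , x≢y with edge-to (full-edge e∈M 2≤ x∈e) | edge-to y∈At
  ... | f , f∈E , s∈f , x∈f | g , g∈E , t∈g , y∈g =
    switch M e∈M x∈e y∈e x≢y f∈E s∈f x∈f g∈E t∈g y∈g s∉C t∉C s≢t

  at-most-2 : ∀ t {e} → e ∈ edges M → ∣ A t ∩ e ∣ ≤ 2
  at-most-2 t {e} e∈M = ≤-trans (∣p∩q∣≤∣q∣ (A t) e) (≤-reflexive (pair G (⊆E M e∈M)))

  augment : Matching G (suc k)
  augment with extend-at u | extend-at v
  ... | inj₁ larger | _           = larger
  ... | inj₂ _      | inj₁ larger = larger
  ... | inj₂ stuck-u | inj₂ stuck-v
    with crowded-edge (many-neighbours u∈V u∉C stuck-u) (many-neighbours v∈V v∉C stuck-v)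
  ... | e , e∈M , 2<
    with split-3 ∣ A u ∩ e ∣ ∣ A v ∩ e ∣ 2< (at-most-2 u e∈M) (at-most-2 v e∈M)
  ... | inj₁ (2≤u , 1≤v) = switch-via u∉C v∉C u≢v e∈M 2≤u 1≤v
  ... | inj₂ (2≤v , 1≤u) = switch-via v∉C u∉C (u≢v ∘ sym) e∈M 2≤v 1≤u

large-matching : (G : Graph n) {q : ℕ} → (∀ {u} → u ∈ˢ V G → q < deg G u) →
                 suc q + suc q ≤ ∣ V G ∣ → Matching G (suc q)
large-matching G {q} min-deg roomy = build (suc q) ≤-refl
  where
  build : ∀ k → k ≤ suc q → Matching G k
  build zero    _     = empty
  build (suc k) k<1+q = Augmentation.augment G
    (λ u∈V → ≤-<-trans (≤-pred k<1+q) (min-deg u∈V))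
    (≤-trans (+-mono-≤ k<1+q k<1+q) roomy)
    (build k (≤-trans (n≤1+n k) k<1+q))

-- Edge numbers of the two extremal graphs without a matching of size q+1:
-- a clique on 2q+1 vertices, and q hub vertices joined to everything else
-- (here d is the number of non-hub vertices).
clique : ℕ → ℕ
clique q = choose2 (q + suc q)

hub : ℕ → ℕ → ℕ
hub q d = choose2 q + q * d

egBound : ℕ → ℕ → ℕ
egBound q m = clique q ⊔ hub q (m ∸ q)

choose2-mono : {a b : ℕ} → a ≤ b → choose2 a ≤ choose2 b
choose2-mono {b = zero}   z≤n       = ≤-refl
choose2-mono {zero} {suc b} _       = z≤n
choose2-mono {suc a} {suc b} (s≤s a≤b) = +-mono-≤ a≤b (choose2-mono a≤b)

egBound-mono : (q m : ℕ) → egBound q m ≤ egBound q (suc m)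
egBound-mono q m = ⊔-monoʳ-≤ (clique q) (+-monoʳ-≤ (choose2 q) (*-monoʳ-≤ q (∸-monoˡ-≤ q (n≤1+n m))))

-- Writing m = q + d removes the truncated subtraction.
egBound-+ : (q d : ℕ) → egBound q (q + d) ≡ clique q ⊔ hub q d
egBound-+ q d = cong (λ x → clique q ⊔ hub q x) (m+n∸m≡n q d)

clique≡ : (q : ℕ) → clique q ≡ q * suc (q + q)
clique≡ zero    = refl
clique≡ (suc q) = begin
  choose2 (suc q + suc (suc q))                      ≡⟨ cong (λ x → (q + suc (suc q)) + choose2 x) (+-suc q (suc q)) ⟩
  (q + suc (suc q)) + ((q + suc q) + clique q)       ≡⟨ cong (λ x → (q + suc (suc q)) + ((q + suc q) + x)) (clique≡ q) ⟩
  (q + suc (suc q)) + ((q + suc q) + q * suc (q + q)) ≡⟨ ring q ⟩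
  suc q * suc (suc q + suc q)                        ∎
  where
  open ≡-Reasoning
  ring : ∀ q → (q + suc (suc q)) + ((q + suc q) + q * suc (q + q)) ≡ suc q * suc (suc q + suc q)
  ring = solve-∀

clique-suc : (q : ℕ) → clique (suc q) ≡ clique q + (q + (q + q)) + (q + 3)
clique-suc q = trans (clique≡ (suc q)) (trans (ring q) (cong (λ x → x + (q + (q + q)) + (q + 3)) (sym (clique≡ q))))
  where
  ring : ∀ q → suc q * suc (suc q + suc q) ≡ q * suc (q + q) + (q + (q + q)) + (q + 3)
  ring = solve-∀

hub-suc : (q d : ℕ) → hub (suc q) d ≡ hub q d + (q + d)
hub-suc q d = ring (choose2 q) q d
  where
  ring : ∀ c q d → (q + c) + suc q * d ≡ (c + q * d) + (q + d)
  ring = solve-∀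

-- Growth of the clique term when a vertex of degree ≤ q + d is deleted: for
-- d ≤ 2q the step to clique (q+1) absorbs it, otherwise the hub graph does.
clique-vertex : (q d : ℕ) → clique q + (q + d) ≤ clique (suc q) ⊔ hub (suc q) d
clique-vertex q d with d ≤? q + q
... | yes d≤2q = ≤-trans (begin
  clique q + (q + d)                         ≤⟨ +-monoʳ-≤ (clique q) (+-monoʳ-≤ q d≤2q) ⟩
  clique q + (q + (q + q))                   ≤⟨ m≤m+n _ (q + 3) ⟩
  clique q + (q + (q + q)) + (q + 3)         ≡⟨ clique-suc q ⟨
  clique (suc q)                             ∎) (m≤m⊔n _ _)
  where open ≤-Reasoning
... | no  d≰2q = ≤-trans (begin
  clique q + (q + d)                         ≡⟨ cong (_+ (q + d)) (clique≡ q) ⟩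
  q * suc (q + q) + (q + d)                  ≤⟨ +-monoˡ-≤ (q + d) (*-monoʳ-≤ q (≰⇒> d≰2q)) ⟩
  q * d + (q + d)                            ≤⟨ +-monoˡ-≤ (q + d) (m≤n+m (q * d) (choose2 q)) ⟩
  hub q d + (q + d)                          ≡⟨ hub-suc q d ⟨
  hub (suc q) d                              ∎) (m≤n⊔m _ _)
  where open ≤-Reasoning

-- The bound absorbs deleting a vertex of degree at most t:  f(q,t) + t ≤ f(q+1,t+1).
egBound-vertex : (q t : ℕ) → q ≤ t → egBound q t + t ≤ egBound (suc q) (suc t)
egBound-vertex q t q≤t =
  subst (λ t → egBound q t + t ≤ egBound (suc q) (suc t)) (m+[n∸m]≡n q≤t) (for-d (t ∸ q))
  where
  open ≤-Reasoning
  for-d : ∀ d → egBound q (q + d) + (q + d) ≤ egBound (suc q) (suc q + d)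
  for-d d = begin
    egBound q (q + d) + (q + d)                ≡⟨ cong (_+ (q + d)) (egBound-+ q d) ⟩
    (clique q ⊔ hub q d) + (q + d)             ≡⟨ +-distribʳ-⊔ (q + d) (clique q) (hub q d) ⟩
    (clique q + (q + d)) ⊔ (hub q d + (q + d)) ≤⟨ ⊔-lub (clique-vertex q d)
                                                         (≤-trans (≤-reflexive (sym (hub-suc q d))) (m≤n⊔m _ _)) ⟩
    clique (suc q) ⊔ hub (suc q) d             ≡⟨ egBound-+ (suc q) d ⟨
    egBound (suc q) (suc q + d)                ∎

-- Growth of both terms when the two ends of an edge, of degrees ≤ q+1 and ≤ 2q+2,
-- are deleted from a graph with d = q + 1 + e non-hub vertices.
clique-edge : (q : ℕ) → clique q + (suc q + (suc q + suc q)) ≤ suc (clique (suc q))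
clique-edge q = begin
  clique q + (suc q + (suc q + suc q))                ≤⟨ m≤m+n _ (suc q) ⟩
  clique q + (suc q + (suc q + suc q)) + suc q        ≡⟨ ring (clique q) q ⟩
  suc (clique q + (q + (q + q)) + (q + 3))            ≡⟨ cong suc (clique-suc q) ⟨
  suc (clique (suc q))                                ∎
  where
  open ≤-Reasoning
  ring : ∀ c q → c + (suc q + (suc q + suc q)) + suc q ≡ suc (c + (q + (q + q)) + (q + 3))
  ring = solve-∀

hub-edge : (q e : ℕ) → hub q (suc q + e) + (suc q + (suc q + suc q)) ≤ suc (hub (suc q) (suc (suc q + e)))
hub-edge q e = begin
  hub q (suc q + e) + (suc q + (suc q + suc q))       ≤⟨ m≤m+n _ e ⟩
  hub q (suc q + e) + (suc q + (suc q + suc q)) + e   ≡⟨ ring (choose2 q) q e ⟩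
  suc (hub (suc q) (suc (suc q + e)))                 ∎
  where
  open ≤-Reasoning
  ring : ∀ c q e → c + q * (suc q + e) + (suc q + (suc q + suc q)) + e ≡ suc ((q + c) + suc q * suc (suc q + e))
  ring = solve-∀

-- The bound absorbs deleting both ends of such an edge:
-- f(q,t) + 3(q+1) ≤ f(q+1,t+2) + 1  when t ≥ 2q+1.
egBound-edge : (q t : ℕ) → q + suc q ≤ t →
               egBound q t + (suc q + (suc q + suc q)) ≤ suc (egBound (suc q) (suc (suc t)))
egBound-edge q t 2q+1≤t =
  subst (λ t → egBound q t + 3q+3 ≤ suc (egBound (suc q) (suc (suc t)))) t≡ (for-e (t ∸ (q + suc q)))
  where
  open ≤-Reasoning
  3q+3 = suc q + (suc q + suc q)
  t≡ : q + (suc q + (t ∸ (q + suc q))) ≡ t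
  t≡ = trans (sym (+-assoc q (suc q) _)) (m+[n∸m]≡n 2q+1≤t)
  for-e : ∀ e → egBound q (q + (suc q + e)) + 3q+3 ≤ suc (egBound (suc q) (suc (suc (q + (suc q + e)))))
  for-e e = begin
    egBound q (q + d) + 3q+3                         ≡⟨ cong (_+ 3q+3) (egBound-+ q d) ⟩
    (clique q ⊔ hub q d) + 3q+3                      ≡⟨ +-distribʳ-⊔ 3q+3 (clique q) (hub q d) ⟩
    (clique q + 3q+3) ⊔ (hub q d + 3q+3)             ≤⟨ ⊔-mono-≤ (clique-edge q) (hub-edge q e) ⟩
    suc (clique (suc q)) ⊔ suc (hub (suc q) (suc d)) ≡⟨ cong suc (egBound-+ (suc q) (suc d)) ⟨
    suc (egBound (suc q) (suc q + suc d))            ≡⟨ cong (λ x → suc (egBound (suc q) (suc x))) (+-suc q d) ⟩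
    suc (egBound (suc q) (suc (suc (q + d))))        ∎
    where d = suc q + e

module _ {n : ℕ} where

  -- A graph on at most m vertices without a matching of size q+1 has at most f(q,m) edges.
  EGBound : ℕ → Set
  EGBound m = ∀ q (G : Graph n) → ∣ V G ∣ ≤ m → ¬ Matching G (suc q) → length (E G) ≤ egBound q m

  few-vertices : (G : Graph n) {q m : ℕ} → ∣ V G ∣ ≤ q + suc q → length (E G) ≤ egBound q m
  few-vertices G {q} few = ≤-trans (∣E∣≤choose2 G) (≤-trans (choose2-mono few) (m≤m⊔n (clique q) _))

  -- A vertex v of degree ≥ 2q+3: delete it and use f(q,m) + m ≤ f(q+1,m+1).
  via-high : {m q : ℕ} → EGBound m → (G : Graph n) {v : Fin n} → ∣ V G ∣ ≤ suc m →
             ¬ Matching G (suc (suc q)) → v ∈ˢ V G → suc q + suc (suc q) ≤ deg G v →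
             length (E G) ≤ egBound (suc q) (suc m)
  via-high {m} {q} IH G {v} ∣V∣≤ no-M v∈V high = begin
    length (E G)                         ≡⟨ ∣E∣≡deg+∣E∖∣ G v ⟩
    deg G v + length (E (G ∖ v))         ≤⟨ +-mono-≤ deg≤m (IH q (G ∖ v) ∣V∖v∣≤m (high-degree G no-M high)) ⟩
    m + egBound q m                      ≡⟨ +-comm m _ ⟩
    egBound q m + m                      ≤⟨ egBound-vertex q m q≤m ⟩
    egBound (suc q) (suc m)              ∎
    where
    open ≤-Reasoning
    deg≤m : deg G v ≤ m
    deg≤m = ≤-pred (≤-trans (deg<∣V∣ G v∈V) ∣V∣≤)
    q≤m : q ≤ m
    q≤m = ≤-trans (m≤m+n q (suc (suc q))) (≤-trans (n≤1+n _) (≤-trans high deg≤m))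
    ∣V∖v∣≤m : ∣ V (G ∖ v) ∣ ≤ m
    ∣V∖v∣≤m = ≤-pred (≤-trans (x∈p⇒∣p-x∣<∣p∣ v∈V) ∣V∣≤)

  via-isolated : {m q : ℕ} → EGBound m → (G : Graph n) {u : Fin n} → ∣ V G ∣ ≤ suc m →
                 ¬ Matching G (suc q) → u ∈ˢ V G → deg G u ≡ 0 → length (E G) ≤ egBound q (suc m)
  via-isolated {m} {q} IH G {u} ∣V∣≤ no-M u∈V isolated = begin
    length (E G)                         ≡⟨ ∣E∣≡deg+∣E∖∣ G u ⟩
    deg G u + length (E (G ∖ u))         ≡⟨ cong (_+ length (E (G ∖ u))) isolated ⟩
    length (E (G ∖ u))                   ≤⟨ IH q (G ∖ u) (≤-pred (≤-trans (x∈p⇒∣p-x∣<∣p∣ u∈V) ∣V∣≤)) (no-M ∘ lift G) ⟩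
    egBound q m                          ≤⟨ egBound-mono q m ⟩
    egBound q (suc m)                    ∎
    where open ≤-Reasoning

  -- An edge uv with deg u ≤ q+1 and deg v ≤ 2q+2: delete both ends and use
  -- f(q,m) + 3(q+1) ≤ f(q+1,m+2) + 1.
  via-edge : {m q : ℕ} → EGBound m → (G : Graph n) {e : Subset n} {u v : Fin n} → ∣ V G ∣ ≤ suc (suc m) →
             q + suc q ≤ m → ¬ Matching G (suc (suc q)) → e ∈ E G → u ∈ˢ e → v ∈ˢ e → u ≢ v →
             deg G u ≤ suc q → deg G v ≤ suc q + suc q → length (E G) ≤ egBound (suc q) (suc (suc m))
  via-edge {m} {q} IH G {e} {u} {v} ∣V∣≤ 2q+1≤m no-M e∈E u∈e v∈e u≢v deg-u deg-v = ≤-pred (begin-strict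
    length (E G)                                  <⟨ ∣E∣<∣E∖∖∣+deg+deg G e∈E u∈e v∈e ⟩
    length (E (G ∖ u ∖ v)) + (deg G u + deg G v)  ≤⟨ +-mono-≤ (IH q (G ∖ u ∖ v) ∣V∖∖∣≤m (without-edge G no-M e∈E u∈e v∈e u≢v))
                                                               (+-mono-≤ deg-u deg-v) ⟩
    egBound q m + (suc q + (suc q + suc q))       ≤⟨ egBound-edge q m 2q+1≤m ⟩
    suc (egBound (suc q) (suc (suc m)))           ∎)
    where
    open ≤-Reasoning
    v∈V∖u : v ∈ˢ V (G ∖ u)
    v∈V∖u = x∈p∧x≢y⇒x∈p-y (inV G e∈E v∈e) (u≢v ∘ sym)
    ∣V∖∖∣≤m : ∣ V (G ∖ u ∖ v) ∣ ≤ m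
    ∣V∖∖∣≤m = ≤-pred (≤-pred (≤-trans (s≤s (x∈p⇒∣p-x∣<∣p∣ v∈V∖u))
                                      (≤-trans (x∈p⇒∣p-x∣<∣p∣ (inV G e∈E u∈e)) ∣V∣≤)))

  -- Many vertices: delete a high-degree vertex, an isolated vertex, or both ends
  -- of an edge at a low-degree vertex; if there is none of these, every degree
  -- exceeds q+1 and there is a matching of size q+2 after all.
  many-vertices : {m q : ℕ} → EGBound (suc m) → EGBound m → (G : Graph n) →
                  ∣ V G ∣ ≤ suc (suc m) → suc q + suc (suc q) < ∣ V G ∣ → ¬ Matching G (suc (suc q)) →
                  length (E G) ≤ egBound (suc q) (suc (suc m))
  many-vertices {m} {q} IH₁ IH₂ G ∣V∣≤ many no-M
    with any? (λ v → (v ∈? V G) ×-dec (suc q + suc (suc q) ≤? deg G v))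
  ... | yes (v , v∈V , high) = via-high IH₁ G ∣V∣≤ no-M v∈V high
  ... | no  no-high with any? (λ u → (u ∈? V G) ×-dec (deg G u ≤? suc q))
  ...   | no  no-low = ⊥-elim (no-M (large-matching G (λ u∈V → ≰⇒> (no-low ∘ (_ ,_) ∘ (u∈V ,_))) many))
  ...   | yes (u , u∈V , low) with isolated-or-edge G u
  ...     | inj₁ isolated = via-isolated IH₁ G ∣V∣≤ no-M u∈V isolated
  ...     | inj₂ (e , e∈E , u∈e) with partner e (pair G e∈E) u
  ...         | v , v∈e , v≢u = via-edge IH₂ G ∣V∣≤ 2q+1≤m no-M e∈E u∈e v∈e (v≢u ∘ sym) low deg-v
    where
    deg-v : deg G v ≤ suc q + suc q
    deg-v = subst (deg G v ≤_) (+-suc q (suc q)) (≤-pred (≰⇒> (no-high ∘ (v ,_) ∘ (inV G e∈E v∈e ,_))))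
    2q+1≤m : q + suc q ≤ m
    2q+1≤m = ≤-trans (+-monoʳ-≤ q (n≤1+n (suc q))) (≤-pred (≤-pred (≤-trans many ∣V∣≤)))

  erdős-gallai : ∀ m → EGBound m
  erdős-gallai = <-rec EGBound step
    where
    step : ∀ m → (∀ {m′} → m′ < m → EGBound m′) → EGBound m
    step m            IH zero    G _     no-M = ≤-trans (≤-reflexive (no-edges G no-M)) z≤n
    step zero          IH (suc q) G ∣V∣≤ no-M = few-vertices G {suc q} {zero} (≤-trans ∣V∣≤ z≤n)
    step (suc zero)    IH (suc q) G ∣V∣≤ no-M = few-vertices G {suc q} {1} (≤-trans ∣V∣≤ (s≤s z≤n))
    step (suc (suc m)) IH (suc q) G ∣V∣≤ no-M with ∣ V G ∣ ≤? suc q + suc (suc q)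
    ... | yes few  = few-vertices G {suc q} {suc (suc m)} few
    ... | no  many = many-vertices (IH (n<1+n (suc m))) (IH (m<n⇒m<1+n (n<1+n m))) G ∣V∣≤ (≰⇒> many) no-M

-- Greedy growth: a list T of members of ℱ can be lengthened by d members of ℱ so
-- that its union gains d points or exhausts ⋃ ℱ (padding uses a fixed member f₀).
grow : (ℱ T : List (Subset n)) {f₀ : Subset n} → f₀ ∈ ℱ → (∀ {f} → f ∈ T → f ∈ ℱ) → (d : ℕ) →
       ∃[ T′ ] (∀ {f} → f ∈ T′ → f ∈ ℱ) × length T′ ≡ d + length T ×
               (∣ ⋃ T ∣ + d ≤ ∣ ⋃ T′ ∣ ⊎ ∣ ⋃ ℱ ∣ ≤ ∣ ⋃ T′ ∣)
grow ℱ T f₀∈ℱ T⊆ℱ zero = T , T⊆ℱ , refl , inj₁ (≤-reflexive (+-identityʳ _))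
grow ℱ T {f₀} f₀∈ℱ T⊆ℱ (suc d) with grow ℱ T f₀∈ℱ T⊆ℱ d
... | T′ , T′⊆ℱ , len , large with ∣ ⋃ ℱ ∣ ≤? ∣ ⋃ T′ ∣
...   | yes full = f₀ ∷ T′ , add f₀∈ℱ , cong suc len , inj₂ (≤-trans full (∣q∣≤∣p∪q∣ f₀ (⋃ T′)))
  where
  add : ∀ {g} → g ∈ ℱ → ∀ {f} → f ∈ g ∷ T′ → f ∈ ℱ
  add g∈ℱ (here refl) = g∈ℱ
  add g∈ℱ (there f∈)  = T′⊆ℱ f∈
...   | no  ¬full with larger⇒∃∉ (⋃ ℱ) (⋃ T′) (≰⇒> ¬full)
...     | x , x∈⋃ℱ , x∉⋃T′ with ∈⋃⁻ ℱ x∈⋃ℱ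
...       | f , f∈ℱ , x∈f = f ∷ T′ , add , cong suc len , inj₁ (begin
  ∣ ⋃ T ∣ + suc d          ≡⟨ +-suc (∣ ⋃ T ∣) d ⟩
  suc (∣ ⋃ T ∣ + d)        ≤⟨ s≤s ([ id , (λ full → contradiction full ¬full) ]′ large) ⟩
  suc ∣ ⋃ T′ ∣             ≤⟨ p⊂q⇒∣p∣<∣q∣ (q⊆p∪q f (⋃ T′) , x , x∈p∪q⁺ (inj₁ x∈f) , x∉⋃T′) ⟩
  ∣ f ∪ ⋃ T′ ∣             ∎)
  where
  open ≤-Reasoning
  add : ∀ {g} → g ∈ f ∷ T′ → g ∈ ℱ
  add (here refl) = f∈ℱ
  add (there g∈)  = T′⊆ℱ g∈

graphOf : (ℱ : List (Subset n)) → Unique ℱ → All (λ F → ∣ F ∣ ≡ 2) ℱ → Graph n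
graphOf ℱ ℱ! ℱ₂ = record
  { V = ⋃ ℱ ; E = ℱ ; pair = All.lookup ℱ₂ ; inV = λ e∈ℱ → ∈⋃⁺ e∈ℱ ; simple = ℱ! }

-- If any s members of ℱ cover at most s+r points but ℱ covers more, then ℱ has
-- no r+1 disjoint members: grow them greedily to s members covering s+r+1 points.
no-matching : (s r : ℕ) → r < s → (ℱ : List (Subset n)) (ℱ! : Unique ℱ) (ℱ₂ : All (λ F → ∣ F ∣ ≡ 2) ℱ) →
              ((Fs : Vec (Subset n) s) → All (_∈ ℱ) (toList Fs) → ∣ ⋃ (toList Fs) ∣ ≤ s + r) →
              s + r < ∣ ⋃ ℱ ∣ → ¬ Matching (graphOf ℱ ℱ! ℱ₂) (suc r)
no-matching s r r<s ℱ ℱ! ℱ₂ H big M with member (edges M) (size M)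
  where
  member : ∀ (xs : List (Subset _)) {k} → length xs ≡ suc k → ∃[ x ] x ∈ xs
  member (x ∷ _) _ = x , here refl
... | f₀ , f₀∈M with grow ℱ (edges M) (⊆E M f₀∈M) (⊆E M) (s ∸ suc r)
...   | T , T⊆ℱ , len , large with asVec s T (trans len (trans (cong (s ∸ suc r +_) (size M)) (m∸n+n≡m r<s)))
...     | Fs , Fs≡T = <⇒≱ s+r<∣⋃T∣ (subst (λ L → ∣ ⋃ L ∣ ≤ s + r) Fs≡T
                        (H Fs (subst (All (_∈ ℱ)) (sym Fs≡T) (All.tabulate T⊆ℱ))))
  where
  open ≤-Reasoning
  s+r<∣⋃M∣+d : s + r < ∣ ⋃ (edges M) ∣ + (s ∸ suc r)
  s+r<∣⋃M∣+d = begin-strict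
    s + r                                 <⟨ n<1+n (s + r) ⟩
    suc (s + r)                           ≡⟨ +-suc s r ⟨
    s + suc r                             ≡⟨ +-comm s (suc r) ⟩
    suc r + s                             ≡⟨ cong (suc r +_) (m+[n∸m]≡n r<s) ⟨
    suc r + (suc r + (s ∸ suc r))         ≡⟨ +-assoc (suc r) (suc r) (s ∸ suc r) ⟨
    suc r + suc r + (s ∸ suc r)           ≤⟨ +-monoˡ-≤ (s ∸ suc r) (spread M) ⟩
    ∣ ⋃ (edges M) ∣ + (s ∸ suc r)         ∎
  s+r<∣⋃T∣ : s + r < ∣ ⋃ T ∣
  s+r<∣⋃T∣ = [ <-≤-trans s+r<∣⋃M∣+d , <-≤-trans big ]′ large

choose2≤max : {n : ℕ} (s r : ℕ) {a : ℕ} → s + r ≤ n → a ≤ s + r →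
              choose2 a ≤ card𝒜 r 1 n 2 ⊔ card𝒜 (s + r) 2 n 2
choose2≤max {n} s r s+r≤n a≤s+r =
  ≤-trans (choose2-mono a≤s+r) (≤-trans (≤-reflexive (sym (card𝒜-inside (s + r) n s+r≤n))) (m≤n⊔m _ _))

egBound≤max : {n : ℕ} (s r : ℕ) → r < s → s + r ≤ n → egBound r n ≤ card𝒜 r 1 n 2 ⊔ card𝒜 (s + r) 2 n 2
egBound≤max {n} s r r<s s+r≤n = ⊔-lub
  (choose2≤max s r s+r≤n (subst (_≤ s + r) (+-comm (suc r) r) (+-monoˡ-≤ r r<s)))
  (≤-trans (≤-reflexive (sym (card𝒜-meeting r n (≤-trans (m≤n+m r s) s+r≤n)))) (m≤m⊔n _ _))

theorem5 : (n s r : ℕ) → 1 ≤ r → r < s → s + r < n →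
    (ℱ : List (Subset n)) → Unique ℱ → All (λ F → ∣ F ∣ ≡ 2) ℱ →
    ((Fs : Vec (Subset n) s) → All (_∈ ℱ) (toList Fs) → ∣ ⋃ (toList Fs) ∣ ≤ s + r) →
    length ℱ ≤ card𝒜 r 1 n 2 ⊔ card𝒜 (s + r) 2 n 2
theorem5 n s r _ r<s s+r<n ℱ ℱ! ℱ₂ H with ∣ ⋃ ℱ ∣ ≤? s + r
... | yes small = ≤-trans (∣E∣≤choose2 (graphOf ℱ ℱ! ℱ₂)) (choose2≤max s r (<⇒≤ s+r<n) small)
... | no  large = ≤-trans
  (erdős-gallai n r (graphOf ℱ ℱ! ℱ₂) (∣p∣≤n (⋃ ℱ)) (no-matching s r r<s ℱ ℱ! ℱ₂ H (≰⇒> large)))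
  (egBound≤max s r r<s (<⇒≤ s+r<n))
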